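{- For any graph $G$, $$\chi(G)=\min_{\mathcal U}\sum_{S\in\mathcal U}\big(1+\operatorname{mad}(G[S])\big),$$ where the minimum is over all partitions $\mathcal U$ of $V(G)$ and $G[S]$ is the induced subgraph on $S$.
   Context: $\operatorname{mad}(G)$ denotes the maximum average degree over all subgraphs of $G$. $\chi$ is the chromatic number. -}

module Defs where

open import Data.Bool using (Bool; true; false; if_then_else_)
open import Data.Nat as ℕ using (ℕ; zero; suc)
open import Data.Fin as Fin using (Fin)
open import Data.Fin.Subset using (Subset; Side; inside; outside; _∩_; ∣_∣)
open import Data.Vec using (Vec; []; _∷_; tabulate; lookup)
open import Data.Integer using (+_)
open import Data.Rational using (ℚ; 0ℚ; 1ℚ; _+_; _⊔_; _/_; _≤_)
open import Data.Product using (Σ; ∃; _×_; _,_)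
open import Relation.Binary.PropositionalEquality using (_≡_; _≢_)
open import Relation.Nullary.Decidable using (⌊_⌋)

record Graph (n : ℕ) : Set where
  field
    adj    : Fin n → Fin n → Bool
    sym    : ∀ u v → adj u v ≡ adj v u
    irrefl : ∀ v → adj v v ≡ false
open Graph public

sumℕ : ∀ {k} → (Fin k → ℕ) → ℕ
sumℕ {zero}  f = 0
sumℕ {suc k} f = f Fin.zero ℕ.+ sumℕ (λ i → f (Fin.suc i))

sumℚ : ∀ {k} → (Fin k → ℚ) → ℚ
sumℚ {zero}  f = 0ℚ
sumℚ {suc k} f = f Fin.zero + sumℚ (λ i → f (Fin.suc i))

ind : Side → ℕ
ind inside  = 1
ind outside = 0

-- Degree sum of the induced subgraph G[T] = number of ordered pairs
-- (u , v) with u , v ∈ T adjacent = 2 |E(G[T])|.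
degSum : ∀ {n} → Graph n → Subset n → ℕ
degSum G T = sumℕ λ u → sumℕ λ v →
  ind (lookup T u) ℕ.* ind (lookup T v) ℕ.* (if adj G u v then 1 else 0)

-- a / b as a rational, with the convention a / 0 = 0.
frac : ℕ → ℕ → ℚ
frac a zero    = 0ℚ
frac a (suc b) = (+ a) / suc b

avgDeg : ∀ {n} → Graph n → Subset n → ℚ
avgDeg G T = frac (degSum G T) ∣ T ∣

maxSubsets : ∀ n → (Subset n → ℚ) → ℚ
maxSubsets zero    f = f []
maxSubsets (suc n) f =
  maxSubsets n (λ T → f (inside ∷ T)) ⊔ maxSubsets n (λ T → f (outside ∷ T))

-- Ranges over all vertex sets T ⊆ S (written as T ∩ S for T arbitrary);
-- for a fixed vertex set the induced subgraph G[T] has the most edges, so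
-- this is the maximum over all subgraphs of G[S]. (0 for empty S.)
mad : ∀ {n} → Graph n → Subset n → ℚ
mad {n} G S = maxSubsets n (λ T → avgDeg G (T ∩ S))

ProperColouring : ∀ {n} → Graph n → (k : ℕ) → (Fin n → Fin k) → Set
ProperColouring G k c = ∀ u v → adj G u v ≡ true → c u ≢ c v

Colourable : ∀ {n} → Graph n → ℕ → Set
Colourable G k = ∃ λ c → ProperColouring G k c

IsChromaticNumber : ∀ {n} → Graph n → ℕ → Set
IsChromaticNumber G χ = Colourable G χ × (∀ k → Colourable G k → χ ℕ.≤ k)

-- A partition of V(G) = Fin n into k nonempty blocks, given by a
-- surjective block-assignment p : Fin n → Fin k.
Surjective : ∀ {n k} → (Fin n → Fin k) → Set
Surjective {n} {k} p = ∀ (i : Fin k) → ∃ λ (v : Fin n) → p v ≡ i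

block : ∀ {n k} → (Fin n → Fin k) → Fin k → Subset n
block p i = tabulate λ v → if ⌊ p v Fin.≟ i ⌋ then inside else outside

partitionCost : ∀ {n k} → Graph n → (Fin n → Fin k) → ℚ
partitionCost G p = sumℚ λ i → 1ℚ + mad G (block p i)

fromℕℚ : ℕ → ℚ
fromℕℚ m = (+ m) / 1

module Submission where

-- The colour classes of an optimal colouring are independent sets, so each has mad 0 and that
-- partition costs exactly χ; optimality also makes every colour class nonempty. Conversely, let
-- S be a block of any partition and d = ⌊mad(G[S])⌋. Every nonempty T ⊆ S has average degree at
-- most mad(G[S]) < d + 1, hence a vertex of degree at most d in G[T]: G[S] is d-degenerate, so
-- greedy colouring uses d + 1 ≤ 1 + mad(G[S]) colours. Giving the blocks disjoint palettes then
-- colours G with a number of colours bounded by the cost of the partition.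

open import Data.Bool using (true; false; if_then_else_; _∧_)
open import Data.Fin using (Fin; zero; suc; _≟_; _↑ˡ_; _↑ʳ_; splitAt; punchOut)
open import Data.Fin.Properties using (any?; ↑ˡ-injective; ↑ʳ-injective; splitAt-↑ˡ; splitAt-↑ʳ; punchOut-injective)
open import Data.Fin.Subset using (Subset; inside; outside; _∈_; _∉_; _⊆_; _∩_; _∪_; _-_; ⁅_⁆; ⊥; ∣_∣; Nonempty)
open import Data.Fin.Subset.Properties
  using (_∈?_; nonempty?; drop-there; ⊆-refl; ⊆-trans; ⊆-antisym; p⊆q⇒∣p∣≤∣q∣; ∣⊥∣≡0; x∈⁅x⁆; x∈p∩q⁺;
         p∩q⊆p; p∩q⊆q; x∈p∪q⁺; ∪-identityʳ; p─q⊆p; x∈p∧x≢y⇒x∈p-y; x∈p⇒∣p-x∣<∣p∣)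
import Data.Integer.Base as ℤ
import Data.Integer.Properties as ℤ
open import Data.Nat.Base using (ℕ; zero; suc; _+_; _*_; _≤_; _<_; z≤n; s≤s; z<s)
open import Data.Nat.DivMod using (_/_; _%_; m≡m%n+[m/n]*n; m%n<n; m/n*n≤m)
open import Data.Nat.Properties hiding (_≟_)
open import Data.Product using (Σ; ∃; _×_; _,_; proj₁; proj₂)
import Data.Product as Product
open import Data.Product.Properties using (Σ-≡,≡←≡)
open import Data.Rational.Base as ℚ using (ℚ; mkℚ; 0ℚ; 1ℚ; toℚᵘ)
import Data.Rational.Properties as ℚ
open import Data.Rational.Unnormalised.Base as ℚᵘ using (mkℚᵘ)
import Data.Rational.Unnormalised.Properties as ℚᵘ
open import Data.Sum using (inj₁; inj₂)
open import Data.Vec using ([]; _∷_; here; there; lookup; tabulate)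
open import Data.Vec.Properties using (lookup∘tabulate; lookup-zipWith; []=⇒lookup; lookup⇒[]=)
open import Function using (_∘_)
open import Relation.Nullary using (¬_; yes; no; contradiction)
open import Relation.Nullary.Decidable using (⌊_⌋; _×-dec_)
open import Relation.Binary.PropositionalEquality

open import Defs hiding (sym)

toℚᵘ-frac : ∀ a b → toℚᵘ (frac a (suc b)) ℚᵘ.≃ mkℚᵘ (ℤ.+ a) b
toℚᵘ-frac a b = ℚ.toℚᵘ-fromℚᵘ (mkℚᵘ (ℤ.+ a) b)

fromℕℚ≤frac : ∀ {m a s} → 0 < s → m * s ≤ a → fromℕℚ m ℚ.≤ frac a s
fromℕℚ≤frac {m} {a} {suc b} _ m*s≤a =
  ℚ.toℚᵘ-cancel-≤ (ℚᵘ.≤-respʳ-≃ (ℚᵘ.≃-sym (toℚᵘ-frac a b))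
                  (ℚᵘ.≤-respˡ-≃ (ℚᵘ.≃-sym (toℚᵘ-frac m 0)) (ℚᵘ.*≤* cross)))
  where
  cross : ℤ.+ m ℤ.* ℤ.+ suc b ℤ.≤ ℤ.+ a ℤ.* ℤ.+ 1
  cross = subst₂ ℤ._≤_ (ℤ.pos-* m (suc b)) (ℤ.pos-* a 1) (ℤ.+≤+ (subst (m * suc b ≤_) (sym (*-identityʳ a)) m*s≤a))

frac<fromℕℚ : ∀ {m a b} → a < m * suc b → frac a (suc b) ℚ.< fromℕℚ m
frac<fromℕℚ {m} {a} {b} a<m*s =
  ℚ.toℚᵘ-cancel-< (ℚᵘ.<-respʳ-≃ (ℚᵘ.≃-sym (toℚᵘ-frac m 0))
                  (ℚᵘ.<-respˡ-≃ (ℚᵘ.≃-sym (toℚᵘ-frac a b)) (ℚᵘ.*<* cross)))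
  where
  cross : ℤ.+ a ℤ.* ℤ.+ 1 ℤ.< ℤ.+ m ℤ.* ℤ.+ suc b
  cross = subst₂ ℤ._<_ (ℤ.pos-* a 1) (ℤ.pos-* m (suc b)) (ℤ.+<+ (subst (_< m * suc b) (sym (*-identityʳ a)) a<m*s))

fromℕℚ-mono-≤ : ∀ {a b} → a ≤ b → fromℕℚ a ℚ.≤ fromℕℚ b
fromℕℚ-mono-≤ {a} {b} a≤b = fromℕℚ≤frac {a} {b} z<s (subst (_≤ b) (sym (*-identityʳ a)) a≤b)

fromℕℚ-+ : ∀ a b → fromℕℚ (a + b) ≡ fromℕℚ a ℚ.+ fromℕℚ b
fromℕℚ-+ a b = ℚ.toℚᵘ-injective (begin
  toℚᵘ (fromℕℚ (a + b))                ≈⟨ toℚᵘ-frac (a + b) 0 ⟩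
  mkℚᵘ (ℤ.+ (a + b)) 0                 ≈⟨ ℚᵘ.*≡* cross ⟩
  mkℚᵘ (ℤ.+ a) 0 ℚᵘ.+ mkℚᵘ (ℤ.+ b) 0   ≈⟨ ℚᵘ.+-cong (toℚᵘ-frac a 0) (toℚᵘ-frac b 0) ⟨
  toℚᵘ (fromℕℚ a) ℚᵘ.+ toℚᵘ (fromℕℚ b) ≈⟨ ℚ.toℚᵘ-homo-+ (fromℕℚ a) (fromℕℚ b) ⟨
  toℚᵘ (fromℕℚ a ℚ.+ fromℕℚ b)         ∎)
  where
  open ℚᵘ.≃-Reasoning
  cross : ℤ.+ (a + b) ℤ.* ℤ.+ 1 ≡ (ℤ.+ a ℤ.* ℤ.+ 1 ℤ.+ ℤ.+ b ℤ.* ℤ.+ 1) ℤ.* ℤ.+ 1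
  cross = cong (ℤ._* ℤ.+ 1) (trans (ℤ.pos-+ a b) (sym (cong₂ ℤ._+_ (ℤ.*-identityʳ (ℤ.+ a)) (ℤ.*-identityʳ (ℤ.+ b)))))

frac-nonNeg : ∀ a s → 0ℚ ℚ.≤ frac a s
frac-nonNeg a zero    = ℚ.≤-refl
frac-nonNeg a (suc b) = fromℕℚ≤frac {0} {a} z<s z≤n

frac-zeroˡ : ∀ s → frac 0 s ≡ 0ℚ
frac-zeroˡ zero    = refl
frac-zeroˡ (suc b) = ℚ.0/n≡0 (suc b)

floor-nonNeg : ∀ q → 0ℚ ℚ.≤ q → ∃ λ d → fromℕℚ d ℚ.≤ q × q ℚ.< fromℕℚ (suc d)
floor-nonNeg (mkℚ (ℤ.+ k) den coprime) _ =
  d , subst (fromℕℚ d ℚ.≤_) q≡k/s (fromℕℚ≤frac {d} z<s (m/n*n≤m k (suc den)))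
    , subst (ℚ._< fromℕℚ (suc d)) q≡k/s (frac<fromℕℚ {suc d} k<[1+d]*s)
  where
  d : ℕ
  d = k / suc den
  q≡k/s : frac k (suc den) ≡ mkℚ (ℤ.+ k) den coprime
  q≡k/s = ℚ.normalize-coprime coprime
  k<[1+d]*s : k < suc d * suc den
  k<[1+d]*s = begin-strict
    k                         ≡⟨ m≡m%n+[m/n]*n k (suc den) ⟩
    k % suc den + d * suc den <⟨ +-monoˡ-< (d * suc den) (m%n<n k (suc den)) ⟩
    suc d * suc den           ∎
    where open ≤-Reasoning
floor-nonNeg (mkℚ ℤ.-[1+ _ ] _ _) (ℚ.*≤* ())

sumℕ-cong : ∀ {k} {f g : Fin k → ℕ} → (∀ i → f i ≡ g i) → sumℕ f ≡ sumℕ g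
sumℕ-cong {zero}  f≗g = refl
sumℕ-cong {suc k} f≗g = cong₂ _+_ (f≗g zero) (sumℕ-cong (f≗g ∘ suc))

sumℕ-zero : ∀ {k} {f : Fin k → ℕ} → (∀ i → f i ≡ 0) → sumℕ f ≡ 0
sumℕ-zero {zero}  f≗0 = refl
sumℕ-zero {suc k} f≗0 = cong₂ _+_ (f≗0 zero) (sumℕ-zero (f≗0 ∘ suc))

sumℕ-mono-≤ : ∀ {k} {f g : Fin k → ℕ} → (∀ i → f i ≤ g i) → sumℕ f ≤ sumℕ g
sumℕ-mono-≤ {zero}  f≤g = z≤n
sumℕ-mono-≤ {suc k} f≤g = +-mono-≤ (f≤g zero) (sumℕ-mono-≤ (f≤g ∘ suc))

sumℕ-*ˡ : ∀ {k} m (f : Fin k → ℕ) → sumℕ (λ i → m * f i) ≡ m * sumℕ f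
sumℕ-*ˡ {zero}  m f = sym (*-zeroʳ m)
sumℕ-*ˡ {suc k} m f = trans (cong (m * f zero +_) (sumℕ-*ˡ m (f ∘ suc))) (sym (*-distribˡ-+ m (f zero) _))

sumℚ-cong : ∀ {k} {f g : Fin k → ℚ} → (∀ i → f i ≡ g i) → sumℚ f ≡ sumℚ g
sumℚ-cong {zero}  f≗g = refl
sumℚ-cong {suc k} f≗g = cong₂ ℚ._+_ (f≗g zero) (sumℚ-cong (f≗g ∘ suc))

sumℚ-mono-≤ : ∀ {k} {f g : Fin k → ℚ} → (∀ i → f i ℚ.≤ g i) → sumℚ f ℚ.≤ sumℚ g
sumℚ-mono-≤ {zero}  f≤g = ℚ.≤-refl
sumℚ-mono-≤ {suc k} f≤g = ℚ.+-mono-≤ (f≤g zero) (sumℚ-mono-≤ (f≤g ∘ suc))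

sumℚ-fromℕℚ : ∀ {k} (f : Fin k → ℕ) → sumℚ (fromℕℚ ∘ f) ≡ fromℕℚ (sumℕ f)
sumℚ-fromℕℚ {zero}  f = refl
sumℚ-fromℕℚ {suc k} f = trans (cong (fromℕℚ (f zero) ℚ.+_) (sumℚ-fromℕℚ (f ∘ suc))) (sym (fromℕℚ-+ (f zero) _))

sumℚ-1ℚ : ∀ k → sumℚ {k} (λ _ → 1ℚ) ≡ fromℕℚ k
sumℚ-1ℚ zero    = refl
sumℚ-1ℚ (suc k) = trans (cong (1ℚ ℚ.+_) (sumℚ-1ℚ k)) (sym (fromℕℚ-+ 1 k))

ind-∧ : ∀ x y → ind (x ∧ y) ≡ ind x * (if y then 1 else 0)
ind-∧ false _     = refl
ind-∧ true  false = refl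
ind-∧ true  true  = refl

∣p∣≡sumℕ-ind : ∀ {n} (p : Subset n) → ∣ p ∣ ≡ sumℕ (ind ∘ lookup p)
∣p∣≡sumℕ-ind []            = refl
∣p∣≡sumℕ-ind (inside  ∷ p) = cong suc (∣p∣≡sumℕ-ind p)
∣p∣≡sumℕ-ind (outside ∷ p) = ∣p∣≡sumℕ-ind p

∣p∣<n⇒∃∉ : ∀ {n} {p : Subset n} → ∣ p ∣ < n → ∃ λ x → x ∉ p
∣p∣<n⇒∃∉ {p = outside ∷ p} _            = zero , λ ()
∣p∣<n⇒∃∉ {p = inside  ∷ p} (s≤s ∣p∣<n) = Product.map suc (λ x∉p → x∉p ∘ drop-there) (∣p∣<n⇒∃∉ ∣p∣<n)

∣p∪⁅x⁆∣≤1+∣p∣ : ∀ {n} (p : Subset n) x → ∣ p ∪ ⁅ x ⁆ ∣ ≤ suc ∣ p ∣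
∣p∪⁅x⁆∣≤1+∣p∣ (inside  ∷ p) zero    rewrite ∪-identityʳ p = n≤1+n _
∣p∪⁅x⁆∣≤1+∣p∣ (outside ∷ p) zero    rewrite ∪-identityʳ p = ≤-refl
∣p∪⁅x⁆∣≤1+∣p∣ (inside  ∷ p) (suc x) = s≤s (∣p∪⁅x⁆∣≤1+∣p∣ p x)
∣p∪⁅x⁆∣≤1+∣p∣ (outside ∷ p) (suc x) = ∣p∪⁅x⁆∣≤1+∣p∣ p x

p⊆q⇒p∩q≡p : ∀ {n} {p q : Subset n} → p ⊆ q → p ∩ q ≡ p
p⊆q⇒p∩q≡p {p = p} {q} p⊆q = ⊆-antisym (p∩q⊆p p q) (λ x∈p → x∈p∩q⁺ (x∈p , p⊆q x∈p))

-- F generalises the statement so that the induction on B can move the colour of each vertex into F.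
unusedColour : ∀ {n m} (c : Fin n → Fin m) (B : Subset n) (F : Subset m) → ∣ B ∣ + ∣ F ∣ < m →
               ∃ λ j → j ∉ F × (∀ {w} → w ∈ B → c w ≢ j)
unusedColour c [] F ∣F∣<m = Product.map₂ (_, λ ()) (∣p∣<n⇒∃∉ ∣F∣<m)
unusedColour c (outside ∷ B) F bound with unusedColour (c ∘ suc) B F bound
... | j , j∉F , unused = j , j∉F , λ { (there w∈B) → unused w∈B }
unusedColour {m = m} c (inside ∷ B) F bound
  with unusedColour (c ∘ suc) B (F ∪ ⁅ c zero ⁆)
         (≤-<-trans (+-monoʳ-≤ ∣ B ∣ (∣p∪⁅x⁆∣≤1+∣p∣ F (c zero))) (subst (_< m) (sym (+-suc ∣ B ∣ ∣ F ∣)) bound))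
... | j , j∉F∪c₀ , unused = j , j∉F∪c₀ ∘ x∈p∪q⁺ ∘ inj₁ , λ
  { here c₀≡j → j∉F∪c₀ (subst (_∈ F ∪ ⁅ c zero ⁆) c₀≡j (x∈p∪q⁺ (inj₂ (x∈⁅x⁆ (c zero)))))
  ; (there w∈B) → unused w∈B }

maxSubsets-≥ : ∀ k (f : Subset k → ℚ) T → f T ℚ.≤ maxSubsets k f
maxSubsets-≥ zero    f []            = ℚ.≤-refl
maxSubsets-≥ (suc k) f (inside  ∷ T) = ℚ.≤-trans (maxSubsets-≥ k (f ∘ (inside ∷_)) T) (ℚ.p≤p⊔q _ _)
maxSubsets-≥ (suc k) f (outside ∷ T) =
  ℚ.≤-trans (maxSubsets-≥ k (f ∘ (outside ∷_)) T) (ℚ.p≤q⊔p (maxSubsets k (f ∘ (inside ∷_))) _)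

maxSubsets-const : ∀ k {f : Subset k → ℚ} {q} → (∀ T → f T ≡ q) → maxSubsets k f ≡ q
maxSubsets-const zero    f≗q = f≗q []
maxSubsets-const (suc k) f≗q =
  trans (cong₂ ℚ._⊔_ (maxSubsets-const k (f≗q ∘ (inside ∷_))) (maxSubsets-const k (f≗q ∘ (outside ∷_)))) (ℚ.⊔-idem _)

lookup-block : ∀ {n k} (p : Fin n → Fin k) i v → lookup (block p i) v ≡ (if ⌊ p v ≟ i ⌋ then inside else outside)
lookup-block p i = lookup∘tabulate (λ w → if ⌊ p w ≟ i ⌋ then inside else outside)

∈block⁺ : ∀ {n k} {p : Fin n → Fin k} {i v} → p v ≡ i → v ∈ block p i
∈block⁺ {p = p} {i} {v} pv≡i with p v ≟ i | lookup-block p i v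
... | yes _    | block[v] = lookup⇒[]= v (block p i) block[v]
... | no pv≢i | _        = contradiction pv≡i pv≢i

∈block⁻ : ∀ {n k} {p : Fin n → Fin k} {i v} → v ∈ block p i → p v ≡ i
∈block⁻ {p = p} {i} {v} v∈block with p v ≟ i | lookup-block p i v
... | yes pv≡i | _        = pv≡i
... | no _     | block[v] = contradiction (trans (sym block[v]) ([]=⇒lookup v∈block)) λ ()

inject : ∀ {k} (ks : Fin k → ℕ) (i : Fin k) → Fin (ks i) → Fin (sumℕ ks)
inject ks zero    j = j ↑ˡ sumℕ (ks ∘ suc)
inject ks (suc i) j = ks zero ↑ʳ inject (ks ∘ suc) i j

inject-injective : ∀ {k} (ks : Fin k → ℕ) {i i′ j j′} → inject ks i j ≡ inject ks i′ j′ →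
                   _≡_ {A = Σ (Fin k) (Fin ∘ ks)} (i , j) (i′ , j′)
inject-injective ks {zero}  {zero}   eq = cong (zero ,_) (↑ˡ-injective _ _ _ eq)
inject-injective ks {zero}  {suc i′} {j} eq
  with () ← trans (sym (splitAt-↑ˡ (ks zero) j _)) (trans (cong (splitAt (ks zero)) eq) (splitAt-↑ʳ (ks zero) _ _))
inject-injective ks {suc i} {zero}   {j′ = j′} eq
  with () ← trans (sym (splitAt-↑ʳ (ks zero) _ _)) (trans (cong (splitAt (ks zero)) eq) (splitAt-↑ˡ (ks zero) j′ _))
inject-injective ks {suc i} {suc i′} eq =
  cong (λ { (i , j) → suc i , j }) (inject-injective (ks ∘ suc) (↑ʳ-injective (ks zero) _ _ eq))

module _ {n : ℕ} (G : Graph n) where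

  neighbours : Fin n → Subset n
  neighbours u = tabulate (adj G u)

  adj⇒∈neighbours : ∀ {u v} → adj G u v ≡ true → v ∈ neighbours u
  adj⇒∈neighbours {u} {v} uv = lookup⇒[]= v (neighbours u) (trans (lookup∘tabulate (adj G u) v) uv)

  degreeIn : Subset n → Fin n → ℕ
  degreeIn T u = ∣ T ∩ neighbours u ∣

  degSum≡sumℕ-degreeIn : ∀ T → degSum G T ≡ sumℕ (λ u → ind (lookup T u) * degreeIn T u)
  degSum≡sumℕ-degreeIn T = sumℕ-cong λ u → begin
    sumℕ (λ v → T[ u ] * T[ v ] * edge u v)         ≡⟨ sumℕ-cong (λ v → *-assoc T[ u ] T[ v ] (edge u v)) ⟩
    sumℕ (λ v → T[ u ] * (T[ v ] * edge u v))       ≡⟨ sumℕ-*ˡ T[ u ] (λ v → T[ v ] * edge u v) ⟩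
    T[ u ] * sumℕ (λ v → T[ v ] * edge u v)         ≡⟨ cong (T[ u ] *_) (sumℕ-cong (ind-lookup-∩ u)) ⟨
    T[ u ] * sumℕ (ind ∘ lookup (T ∩ neighbours u)) ≡⟨ cong (T[ u ] *_) (∣p∣≡sumℕ-ind (T ∩ neighbours u)) ⟨
    T[ u ] * degreeIn T u                           ∎
    where
    open ≡-Reasoning
    T[_] : Fin n → ℕ
    T[ v ] = ind (lookup T v)
    edge : Fin n → Fin n → ℕ
    edge u v = if adj G u v then 1 else 0
    ind-lookup-∩ : ∀ u v → ind (lookup (T ∩ neighbours u) v) ≡ T[ v ] * edge u v
    ind-lookup-∩ u v rewrite lookup-zipWith _∧_ v T (neighbours u) | lookup∘tabulate (adj G u) v =
      ind-∧ (lookup T v) (adj G u v)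

  ProperColouringOn : Subset n → (k : ℕ) → (Fin n → Fin k) → Set
  ProperColouringOn S k c = ∀ {u v} → u ∈ S → v ∈ S → adj G u v ≡ true → c u ≢ c v

  ColourableOn : Subset n → ℕ → Set
  ColourableOn S k = ∃ (ProperColouringOn S k)

  Degenerate : ℕ → Subset n → Set
  Degenerate d S = ∀ {T} → T ⊆ S → Nonempty T → ∃ λ u → u ∈ T × degreeIn T u ≤ d

  colourVertex : ∀ {d S u} → u ∈ S → degreeIn S u ≤ d → ColourableOn (S - u) (suc d) → ColourableOn S (suc d)
  colourVertex {d} {S} {u} u∈S deg≤d (c , c-proper) = c′ , c′-proper
    where
    N : Subset n
    N = (S - u) ∩ neighbours u
    bound : ∣ N ∣ + ∣ ⊥ {suc d} ∣ < suc d
    bound rewrite ∣⊥∣≡0 (suc d) | +-identityʳ ∣ N ∣ = s≤s (≤-trans (p⊆q⇒∣p∣≤∣q∣ N⊆S∩N) deg≤d)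
      where
      N⊆S∩N : N ⊆ S ∩ neighbours u
      N⊆S∩N w∈N = x∈p∩q⁺ (p─q⊆p S ⁅ u ⁆ (p∩q⊆p _ _ w∈N) , p∩q⊆q _ _ w∈N)
    free : ∃ λ j → j ∉ ⊥ × (∀ {w} → w ∈ N → c w ≢ j)
    free = unusedColour c N ⊥ bound
    j : Fin (suc d)
    j = proj₁ free
    unused : ∀ {w} → w ∈ S → w ≢ u → adj G u w ≡ true → c w ≢ j
    unused w∈S w≢u uw = proj₂ (proj₂ free) (x∈p∩q⁺ (x∈p∧x≢y⇒x∈p-y w∈S w≢u , adj⇒∈neighbours uw))
    c′ : Fin n → Fin (suc d)
    c′ v with v ≟ u
    ... | yes _ = j
    ... | no  _ = c v
    c′-proper : ProperColouringOn S (suc d) c′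
    c′-proper {v} {w} v∈S w∈S vw with v ≟ u | w ≟ u
    ... | yes refl | yes refl = contradiction (trans (sym vw) (irrefl G u)) λ ()
    ... | yes refl | no w≢u  = unused w∈S w≢u vw ∘ sym
    ... | no v≢u  | yes refl = unused v∈S v≢u (trans (Graph.sym G u v) vw)
    ... | no v≢u  | no w≢u   = c-proper (x∈p∧x≢y⇒x∈p-y v∈S v≢u) (x∈p∧x≢y⇒x∈p-y w∈S w≢u) vw

  degenerate⇒colourableOn : ∀ {d S} → Degenerate d S → ColourableOn S (suc d)
  degenerate⇒colourableOn {d} {S} = go (suc ∣ S ∣) S ≤-refl
    where
    go : ∀ m S → ∣ S ∣ < m → Degenerate d S → ColourableOn S (suc d)
    go (suc m) S (s≤s ∣S∣≤m) S-degenerate with nonempty? S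
    ... | no S-empty = (λ _ → zero) , λ u∈S → contradiction (_ , u∈S) S-empty
    ... | yes S-nonempty with S-degenerate ⊆-refl S-nonempty
    ...   | u , u∈S , deg≤d = colourVertex u∈S deg≤d
            (go m (S - u) (<-≤-trans (x∈p⇒∣p-x∣<∣p∣ u∈S) ∣S∣≤m)
                (λ T⊆S-u → S-degenerate (⊆-trans T⊆S-u (p─q⊆p S ⁅ u ⁆))))

  avgDeg-≥ : ∀ {T m} → Nonempty T → (∀ {u} → u ∈ T → m ≤ degreeIn T u) → fromℕℚ m ℚ.≤ avgDeg G T
  avgDeg-≥ {T} {m} (v , v∈T) m≤deg = fromℕℚ≤frac {m} (≤-<-trans z≤n (x∈p⇒∣p-x∣<∣p∣ v∈T)) (begin
    m * ∣ T ∣                                    ≡⟨ cong (m *_) (∣p∣≡sumℕ-ind T) ⟩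
    m * sumℕ (ind ∘ lookup T)                    ≡⟨ sumℕ-*ˡ m (ind ∘ lookup T) ⟨
    sumℕ (λ u → m * ind (lookup T u))            ≤⟨ sumℕ-mono-≤ pointwise ⟩
    sumℕ (λ u → ind (lookup T u) * degreeIn T u) ≡⟨ degSum≡sumℕ-degreeIn T ⟨
    degSum G T                                   ∎)
    where
    open ≤-Reasoning
    pointwise : ∀ u → m * ind (lookup T u) ≤ ind (lookup T u) * degreeIn T u
    pointwise u with lookup T u in T[u]
    ... | outside = ≤-reflexive (*-zeroʳ m)
    ... | inside  = subst₂ _≤_ (sym (*-identityʳ m)) (sym (+-identityʳ _)) (m≤deg (lookup⇒[]= u T T[u]))

  avgDeg≤mad : ∀ {S T} → T ⊆ S → avgDeg G T ℚ.≤ mad G S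
  avgDeg≤mad {S} {T} T⊆S =
    subst (λ X → avgDeg G X ℚ.≤ mad G S) (p⊆q⇒p∩q≡p T⊆S) (maxSubsets-≥ n (λ X → avgDeg G (X ∩ S)) T)

  mad-nonNeg : ∀ S → 0ℚ ℚ.≤ mad G S
  mad-nonNeg S = ℚ.≤-trans (frac-nonNeg (degSum G S) ∣ S ∣) (avgDeg≤mad ⊆-refl)

  mad<⇒degenerate : ∀ {d S} → mad G S ℚ.< fromℕℚ (suc d) → Degenerate d S
  mad<⇒degenerate {d} mad<1+d {T} T⊆S T-nonempty with any? (λ u → u ∈? T ×-dec degreeIn T u ≤? d)
  ... | yes found = found
  ... | no  none  = contradiction
    (ℚ.≤-<-trans (ℚ.≤-trans (avgDeg-≥ T-nonempty deg>d) (avgDeg≤mad T⊆S)) mad<1+d) (ℚ.<-irrefl refl)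
    where
    deg>d : ∀ {u} → u ∈ T → suc d ≤ degreeIn T u
    deg>d u∈T = ≰⇒> λ deg≤d → none (_ , u∈T , deg≤d)

  colourableOn-≤1+mad : ∀ S → ∃ λ k → fromℕℚ k ℚ.≤ 1ℚ ℚ.+ mad G S × ColourableOn S k
  colourableOn-≤1+mad S with floor-nonNeg (mad G S) (mad-nonNeg S)
  ... | d , d≤mad , mad<1+d =
    suc d , subst (ℚ._≤ 1ℚ ℚ.+ mad G S) (sym (fromℕℚ-+ 1 d)) (ℚ.+-monoʳ-≤ 1ℚ d≤mad)
          , degenerate⇒colourableOn (mad<⇒degenerate mad<1+d)

  colourable-from-blocks : ∀ {k} (p : Fin n → Fin k) (ks : Fin k → ℕ) →
                           (∀ i → ColourableOn (block p i) (ks i)) → Colourable G (sumℕ ks)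
  colourable-from-blocks p ks colour = C , C-proper
    where
    C : Fin n → Fin (sumℕ ks)
    C v = inject ks (p v) (proj₁ (colour (p v)) v)
    C-proper : ProperColouring G (sumℕ ks) C
    C-proper u v uv Cu≡Cv = distinct refl refl (Σ-≡,≡←≡ (inject-injective ks Cu≡Cv))
      where
      distinct : ∀ {i i′} → p u ≡ i → p v ≡ i′ →
                 ¬ Σ (i ≡ i′) (λ e → subst (Fin ∘ ks) e (proj₁ (colour i) u) ≡ proj₁ (colour i′) v)
      distinct pu≡i pv≡i (refl , same-colour) = proj₂ (colour _) (∈block⁺ pu≡i) (∈block⁺ pv≡i) uv same-colour

  χ≤partitionCost : ∀ {χ k} → (∀ k → Colourable G k → χ ≤ k) →
                    (p : Fin n → Fin k) → fromℕℚ χ ℚ.≤ partitionCost G p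
  χ≤partitionCost {χ} χ-minimal p = begin
    fromℕℚ χ           ≤⟨ fromℕℚ-mono-≤ (χ-minimal _ colourable) ⟩
    fromℕℚ (sumℕ ks)   ≡⟨ sumℚ-fromℕℚ ks ⟨
    sumℚ (fromℕℚ ∘ ks) ≤⟨ sumℚ-mono-≤ (proj₁ ∘ proj₂ ∘ blockColouring) ⟩
    partitionCost G p  ∎
    where
    open ℚ.≤-Reasoning
    blockColouring : ∀ i → ∃ λ k → fromℕℚ k ℚ.≤ 1ℚ ℚ.+ mad G (block p i) × ColourableOn (block p i) k
    blockColouring i = colourableOn-≤1+mad (block p i)
    ks : Fin _ → ℕ
    ks = proj₁ ∘ blockColouring
    colourable : Colourable G (sumℕ ks)
    colourable = colourable-from-blocks p ks (proj₂ ∘ proj₂ ∘ blockColouring)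

  Independent : Subset n → Set
  Independent S = ∀ {u v} → u ∈ S → v ∈ S → adj G u v ≡ false

  colourClass-independent : ∀ {k c} → ProperColouring G k c → ∀ i → Independent (block c i)
  colourClass-independent c-proper i {u} {v} u∈ v∈ with adj G u v in uv
  ... | false = refl
  ... | true  = contradiction (trans (∈block⁻ u∈) (sym (∈block⁻ v∈))) (c-proper u v uv)

  independent⇒degSum≡0 : ∀ {S} → Independent S → degSum G S ≡ 0
  independent⇒degSum≡0 {S} S-independent = sumℕ-zero λ u → sumℕ-zero λ v → no-edge u v
    where
    no-edge : ∀ u v → ind (lookup S u) * ind (lookup S v) * (if adj G u v then 1 else 0) ≡ 0
    no-edge u v with lookup S u in S[u] | lookup S v in S[v]
    ... | outside | _       = refl
    ... | inside  | outside = refl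
    ... | inside  | inside  rewrite S-independent (lookup⇒[]= u S S[u]) (lookup⇒[]= v S S[v]) = refl

  independent⇒mad≡0 : ∀ {S} → Independent S → mad G S ≡ 0ℚ
  independent⇒mad≡0 {S} S-independent = maxSubsets-const n λ T →
    trans (cong (λ e → frac e ∣ T ∩ S ∣) (independent⇒degSum≡0 (T∩S-independent {T}))) (frac-zeroˡ ∣ T ∩ S ∣)
    where
    T∩S-independent : ∀ {T} → Independent (T ∩ S)
    T∩S-independent {T} u∈ v∈ = S-independent (p∩q⊆q T S u∈) (p∩q⊆q T S v∈)

  partitionCost-colourClasses : ∀ {k c} → ProperColouring G k c → partitionCost G c ≡ fromℕℚ k
  partitionCost-colourClasses {k} c-proper = trans (sumℚ-cong cost≡1) (sumℚ-1ℚ k)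
    where
    cost≡1 : ∀ i → 1ℚ ℚ.+ mad G (block _ i) ≡ 1ℚ
    cost≡1 i = trans (cong (1ℚ ℚ.+_) (independent⇒mad≡0 (colourClass-independent c-proper i))) (ℚ.+-identityʳ 1ℚ)

  optimalColouring-surjective : ∀ {χ c} → ProperColouring G χ c → (∀ k → Colourable G k → χ ≤ k) →
                                Surjective c
  optimalColouring-surjective {suc χ′} {c} c-proper χ-minimal i with any? (λ v → c v ≟ i)
  ... | yes hit    = hit
  ... | no  missed = contradiction (χ-minimal χ′ (c′ , c′-proper)) 1+n≰n
    where
    i≢c : ∀ v → i ≢ c v
    i≢c v i≡cv = missed (v , sym i≡cv)
    c′ : Fin n → Fin χ′
    c′ v = punchOut (i≢c v)
    c′-proper : ProperColouring G χ′ c′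
    c′-proper u v uv = c-proper u v uv ∘ punchOut-injective (i≢c u) (i≢c v)

lemma3p3 : ∀ (n : ℕ) (G : Graph n) (χ : ℕ) → IsChromaticNumber G χ →
    (∃ λ (k : ℕ) → Σ (Fin n → Fin k) λ p →
        Surjective p × (partitionCost G p ≡ fromℕℚ χ))
    × (∀ (k : ℕ) (p : Fin n → Fin k) → Surjective p →
        fromℕℚ χ ℚ.≤ partitionCost G p)
lemma3p3 n G χ ((c , c-proper) , χ-minimal) =
  (χ , c , optimalColouring-surjective G c-proper χ-minimal , partitionCost-colourClasses G c-proper)
  , λ k p _ → χ≤partitionCost G χ-minimal p
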